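{- Let $\mathcal{S}$ be a realizability structure and $t$ a term. Then $t$ is a may-nondeterministic choice operator modulo $\succ_{\mathcal{S}}$ if and only if $t$ realizes $\forall X\forall Y\,(X\to Y\to X\cap Y)$ with respect to $\mathcal{S}$; and $t$ is a must-nondeterministic choice operator modulo $\succ_{\mathcal{S}}$ if and only if $t$ realizes $\forall X\forall Y\,(X\to Y\to X\cup Y)$ with respect to $\mathcal{S}$.
   Context: $\lambda_c$-calculus. Fix a countably infinite set of variables. $\lambda_c$-terms: $t,u ::= x \mid tu \mid \lambda x.t \mid \mathrm{cc} \mid k_\pi$ ($\pi$ a stack) $\mid \kappa_m$ ($m\in\mathbb{N}$) $\mid \beta_m$ ($m\in\mathbb{N}$), modulo $\alpha$-equivalence. A term is a closed $\lambda_c$-term; $\Lambda$ the set of terms. Stacks: $\pi ::= \omega_m \mid t\cdot\pi$; $\Pi$ the set of stacks. Processes: $t\star\pi$. One-step evaluation $\succ_1$: $tu\star\pi \succ_1 t\star u\cdot\pi$, $\lambda x.t\star u\cdot\pi\succ_1 t[x:=u]\star\pi$, $\mathrm{cc}\star t\cdot\pi\succ_1 t\star k_\pi\cdot\pi$, $k_{\pi'}\star t\cdot\pi\succ_1 t\star\pi'$; $\succ$ its reflexive-transitive closure. A pole is a set $\perp\!\!\!\perp$ of processes with $p\succ q$, $q\in\perp\!\!\!\perp\Rightarrow p\in\perp\!\!\!\perp$. A realizability structure is a set $\mathcal{S}$ of poles. For a pole and closed formulas built from subsets $S\subseteq\Pi$ (as constants), $\to$, $\cap$, $\cup$ and $\forall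 X$ ($X$ nullary second-order variable): $\|S\|=S$, $\|A\to B\|=\{t\cdot\pi:t\in|A|,\pi\in\|B\|\}$, $\|A\cap B\|=\|A\|\cup\|B\|$, $\|A\cup B\|=\|A\|\cap\|B\|$, $\|\forall X\,A\|=\bigcup_{S\subseteq\Pi}\|A[X:=S]\|$; $|A|=\{t\in\Lambda:\forall\pi\in\|A\|,\ t\star\pi\in\perp\!\!\!\perp\}$. A term realizes $A$ w.r.t. $\mathcal{S}$ if it lies in $|A|$ for every pole of $\mathcal{S}$. $\succ_{\mathcal{S}}$ is the relation on sets of processes: $P\succ_{\mathcal{S}}Q$ iff for all $\perp\!\!\!\perp\in\mathcal{S}$, $Q\subseteq\perp\!\!\!\perp$ implies $P\cap\perp\!\!\!\perp\ne\emptyset$. A may-nondeterministic choice operator (fork instruction) modulo $\succ_{\mathcal{S}}$ is a term $\psi$ such that for all terms $u,v$ and stacks $\pi$: $\{\psi\star u\cdot v\cdot\pi\}\succ_{\mathcal{S}}\{u\star\pi\}$ and $\{\psi\star u\cdot v\cdot\pi\}\succ_{\mathcal{S}}\{v\star\pi\}$. A must-nondeterministic choice operator modulo $\succ_{\mathcal{S}}$ is a term $\chi$ such that for all terms $u,v$ and stacks $\pi$: $\{\chi\star u\cdot v\cdot\pi\}\succ_{\mathcal{S}}\{u\star\pi,v\star\pi\}$. -}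

module Defs where

open import Level using (Level; 0ℓ; Lift; lift) renaming (suc to lsuc)
open import Data.Nat using (ℕ; zero; suc)
open import Data.Fin using (Fin; zero; suc; punchOut; _≟_)
open import Data.Empty using (⊥; ⊥-elim)
open import Data.Product using (Σ; _×_; _,_)
open import Data.Sum using (_⊎_)
open import Relation.Nullary using (yes; no)
open import Relation.Unary using (Pred; _⊆_)
open import Relation.Binary.PropositionalEquality using (_≡_)
open import Relation.Binary.Construct.Closure.ReflexiveTransitive using (Star)

-- λc-terms, with de Bruijn indices (so α-equivalence is syntactic
-- equality).  Tm n = λc-terms with at most n free variables;
-- "terms" are the closed ones, Tm 0.  Stacks contain closed terms.

mutual
  data Tm (n : ℕ) : Set where
    var : Fin n → Tm n
    app : Tm n → Tm n → Tm n
    lam : Tm (suc n) → Tm n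
    cc  : Tm n
    k   : Stack → Tm n
    κ   : ℕ → Tm n
    β   : ℕ → Tm n

  data Stack : Set where
    ω   : ℕ → Stack
    _·_ : Tm 0 → Stack → Stack

infixr 5 _·_

Λ : Set
Λ = Tm 0

Π : Set
Π = Stack

liftR : ∀ {m n} → (Fin m → Fin n) → Fin (suc m) → Fin (suc n)
liftR f zero    = zero
liftR f (suc i) = suc (f i)

ren : ∀ {m n} → (Fin m → Fin n) → Tm m → Tm n
ren f (var i)   = var (f i)
ren f (app t u) = app (ren f t) (ren f u)
ren f (lam t)   = lam (ren (liftR f) t)
ren f cc        = cc
ren f (k π)     = k π
ren f (κ m)     = κ m
ren f (β m)     = β m

weaken : ∀ {n} → Λ → Tm n
weaken = ren (λ ())

substAt : ∀ {n} → Fin (suc n) → Λ → Tm (suc n) → Tm n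
substAt i u (var j) with i ≟ j
... | yes _  = weaken u
... | no i≢j = var (punchOut i≢j)
substAt i u (app t s) = app (substAt i u t) (substAt i u s)
substAt i u (lam t)   = lam (substAt (suc i) u t)
substAt i u cc        = cc
substAt i u (k π)     = k π
substAt i u (κ m)     = κ m
substAt i u (β m)     = β m

_[0:=_] : Tm 1 → Λ → Λ
t [0:= u ] = substAt zero u t

infix 4 _⋆_
record Process : Set where
  constructor _⋆_
  field
    term  : Λ
    stack : Π

infix 3 _≻₁_ _≻_
data _≻₁_ : Process → Process → Set where
  push : ∀ {t u π}    → app t u ⋆ π ≻₁ t ⋆ u · π
  grab : ∀ {t u π}    → lam t ⋆ u · π ≻₁ (t [0:= u ]) ⋆ π
  save : ∀ {t π}      → cc ⋆ t · π ≻₁ t ⋆ k π · π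
  rest : ∀ {π' t π}   → k π' ⋆ t · π ≻₁ t ⋆ π'

_≻_ : Process → Process → Set
_≻_ = Star _≻₁_

record Pole : Set₁ where
  field
    ⊥⊥     : Pred Process 0ℓ
    closed : ∀ {p q} → p ≻ q → ⊥⊥ q → ⊥⊥ p

open Pole public

RealizabilityStructure : Set₂
RealizabilityStructure = Pred Pole (lsuc 0ℓ)

-- Formulas: subsets of Π as constants, →, ∩, ∪, ∀X (nullary second
-- order variables, de Bruijn indexed).

data Formula (n : ℕ) : Set₁ where
  const : Pred Π 0ℓ → Formula n
  fvar  : Fin n → Formula n
  _⇒_   : Formula n → Formula n → Formula n
  _∩_   : Formula n → Formula n → Formula n
  _∪_   : Formula n → Formula n → Formula n
  `∀    : Formula (suc n) → Formula n

infixr 4 _⇒_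
infixr 6 _∩_ _∪_

Env : ℕ → Set₁
Env n = Fin n → Pred Π 0ℓ

extend : ∀ {n} → Pred Π 0ℓ → Env n → Env (suc n)
extend S ρ zero    = S
extend S ρ (suc i) = ρ i

-- falsity value ‖A‖ and truth value |A| w.r.t. a pole
-- (with environment ρ interpreting the free variables; for closed
-- formulas this is the substitution semantics of the paper).
mutual
  ‖_‖⟨_⟩_ : ∀ {n} → Formula n → Pole → Env n → Pred Π (lsuc 0ℓ)
  ‖ const S ‖⟨ P ⟩ ρ = λ π → Lift (lsuc 0ℓ) (S π)
  ‖ fvar i  ‖⟨ P ⟩ ρ = λ π → Lift (lsuc 0ℓ) (ρ i π)
  ‖ A ⇒ B   ‖⟨ P ⟩ ρ = λ π → Σ Λ λ t → Σ Π λ π' →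
                          (π ≡ t · π') × (∣ A ∣⟨ P ⟩ ρ) t × (‖ B ‖⟨ P ⟩ ρ) π'
  ‖ A ∩ B   ‖⟨ P ⟩ ρ = λ π → (‖ A ‖⟨ P ⟩ ρ) π ⊎ (‖ B ‖⟨ P ⟩ ρ) π
  ‖ A ∪ B   ‖⟨ P ⟩ ρ = λ π → (‖ A ‖⟨ P ⟩ ρ) π × (‖ B ‖⟨ P ⟩ ρ) π
  ‖ `∀ A    ‖⟨ P ⟩ ρ = λ π → Σ (Pred Π 0ℓ) λ S → (‖ A ‖⟨ P ⟩ extend S ρ) π

  ∣_∣⟨_⟩_ : ∀ {n} → Formula n → Pole → Env n → Pred Λ (lsuc 0ℓ)
  ∣ A ∣⟨ P ⟩ ρ = λ t → ∀ π → (‖ A ‖⟨ P ⟩ ρ) π → ⊥⊥ P (t ⋆ π)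

empty : Env 0
empty ()

Realizes : RealizabilityStructure → Λ → Formula 0 → Set₁
Realizes 𝒮 t A = ∀ P → 𝒮 P → (∣ A ∣⟨ P ⟩ empty) t

_≻[_]_ : Pred Process 0ℓ → RealizabilityStructure → Pred Process 0ℓ → Set₁
Pset ≻[ 𝒮 ] Q = ∀ P → 𝒮 P → Q ⊆ ⊥⊥ P → Σ Process λ p → Pset p × ⊥⊥ P p

｛_｝ : Process → Pred Process 0ℓ
｛ p ｝ = λ q → q ≡ p

｛_,_｝ : Process → Process → Pred Process 0ℓ
｛ p , p' ｝ = λ q → (q ≡ p) ⊎ (q ≡ p')

MayChoice : RealizabilityStructure → Λ → Set₁
MayChoice 𝒮 ψ = ∀ (u v : Λ) (π : Π) →
  (｛ ψ ⋆ u · v · π ｝ ≻[ 𝒮 ] ｛ u ⋆ π ｝) × (｛ ψ ⋆ u · v · π ｝ ≻[ 𝒮 ] ｛ v ⋆ π ｝)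

MustChoice : RealizabilityStructure → Λ → Set₁
MustChoice 𝒮 χ = ∀ (u v : Λ) (π : Π) →
  ｛ χ ⋆ u · v · π ｝ ≻[ 𝒮 ] ｛ u ⋆ π , v ⋆ π ｝

-- ∀X∀Y (X → Y → X∩Y)  and  ∀X∀Y (X → Y → X∪Y);  X = index 1, Y = index 0
X Y : Formula 2
X = fvar (suc zero)
Y = fvar zero

MayType : Formula 0
MayType = `∀ (`∀ (X ⇒ Y ⇒ X ∩ Y))

MustType : Formula 0
MustType = `∀ (`∀ (X ⇒ Y ⇒ X ∪ Y))

module Submission where

-- Both sides unfold to a statement about each pole
-- ⊥⊥ of 𝒮 separately:
--   * may  : t ⋆ u·v·π ∈ ⊥⊥ as soon as u ⋆ π ∈ ⊥⊥ or v ⋆ π ∈ ⊥⊥;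
--   * must : t ⋆ u·v·π ∈ ⊥⊥ as soon as u ⋆ π ∈ ⊥⊥ and v ⋆ π ∈ ⊥⊥.
-- For the choice operators this is immediate from the definition of ≻_𝒮
-- with a singleton on the left (mayChoiceCriterion, mustChoiceCriterion).
-- For the realizability side, the truth value of ∀X∀Y (X → Y → B) is
-- unfolded once for an arbitrary conclusion B (binaryRealizer); the per-pole
-- condition then follows by instantiating X, Y with the singleton {π} and
-- the empty set of stacks (u ⋆ π ∈ ⊥⊥ gives u ∈ |{π}|, and every term lies
-- in |∅|), and conversely implies the realizability condition for arbitrary
-- X, Y by a case analysis on π ∈ ‖X ∩ Y‖ or π ∈ ‖X ∪ Y‖ (mayAtPole,
-- mustAtPole).

open import Defs
open import Level using (0ℓ; lift)
open import Data.Product using (_×_; _,_; proj₁; proj₂)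
open import Data.Sum using (_⊎_; inj₁; inj₂)
open import Function.Bundles using (_⇔_; mk⇔; Equivalence)
open import Function.Construct.Composition using (_⇔-∘_)
open import Function.Construct.Symmetry using (⇔-sym)
open import Relation.Unary using (Pred; _⊆_; ∅) renaming (｛_｝ to ｛_｝ₛ)
open import Relation.Binary.PropositionalEquality using (refl)

open Equivalence using (to; from)

module _ (P : Pole) where

  TruthValue : Pred Π 0ℓ → Λ → Set
  TruthValue S u = ∀ π → S π → ⊥⊥ P (u ⋆ π)

  singletonTruth : ∀ {u π} → ⊥⊥ P (u ⋆ π) → TruthValue ｛ π ｝ₛ u
  singletonTruth u⋆π∈⊥⊥ _ refl = u⋆π∈⊥⊥

  emptyTruth : ∀ {u} → TruthValue ∅ u
  emptyTruth _ ()

  BinaryAt : Formula 2 → Λ → Set₁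
  BinaryAt B t = ∀ S S' u v π → TruthValue S u → TruthValue S' v →
    (‖ B ‖⟨ P ⟩ extend S' (extend S empty)) π → ⊥⊥ P (t ⋆ u · v · π)

  MayAt : Λ → Set
  MayAt t = ∀ u v π → ⊥⊥ P (u ⋆ π) ⊎ ⊥⊥ P (v ⋆ π) → ⊥⊥ P (t ⋆ u · v · π)

  MustAt : Λ → Set
  MustAt t = ∀ u v π → ⊥⊥ P (u ⋆ π) → ⊥⊥ P (v ⋆ π) → ⊥⊥ P (t ⋆ u · v · π)

  binaryRealizer : (B : Formula 2) (t : Λ) →
    (∣ `∀ (`∀ (X ⇒ Y ⇒ B)) ∣⟨ P ⟩ empty) t ⇔ BinaryAt B t
  binaryRealizer B t = mk⇔ unfold fold
    where
    unfold : (∣ `∀ (`∀ (X ⇒ Y ⇒ B)) ∣⟨ P ⟩ empty) t → BinaryAt B t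
    unfold r S S' u v π u∈S v∈S' π∈B =
      r (u · v · π) (S , S' , u , v · π , refl , (λ σ (lift σ∈S) → u∈S σ σ∈S)
                                 , v , π , refl , (λ σ (lift σ∈S') → v∈S' σ σ∈S') , π∈B)
    fold : BinaryAt B t → (∣ `∀ (`∀ (X ⇒ Y ⇒ B)) ∣⟨ P ⟩ empty) t
    fold h ._ (S , S' , u , ._ , refl , u∈S , v , π , refl , v∈S' , π∈B) =
      h S S' u v π (λ σ σ∈S → u∈S σ (lift σ∈S)) (λ σ σ∈S' → v∈S' σ (lift σ∈S')) π∈B

  -- Forward: take
  -- X := {π}, Y := ∅ (or the other way round); backward: π ∈ ‖X ∩ Y‖ means
  -- π ∈ X or π ∈ Y, and the corresponding argument then has u ⋆ π ∈ ⊥⊥.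
  mayAtPole : (t : Λ) → (∣ MayType ∣⟨ P ⟩ empty) t ⇔ MayAt t
  mayAtPole t = mk⇔ useRealizer buildRealizer ⇔-∘ binaryRealizer (X ∩ Y) t
    where
    useRealizer : BinaryAt (X ∩ Y) t → MayAt t
    useRealizer r u v π (inj₁ u⋆π∈⊥⊥) =
      r ｛ π ｝ₛ ∅ u v π (singletonTruth u⋆π∈⊥⊥) emptyTruth (inj₁ (lift refl))
    useRealizer r u v π (inj₂ v⋆π∈⊥⊥) =
      r ∅ ｛ π ｝ₛ u v π emptyTruth (singletonTruth v⋆π∈⊥⊥) (inj₂ (lift refl))
    buildRealizer : MayAt t → BinaryAt (X ∩ Y) t
    buildRealizer h S S' u v π u∈S v∈S' (inj₁ (lift π∈S))  = h u v π (inj₁ (u∈S π π∈S))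
    buildRealizer h S S' u v π u∈S v∈S' (inj₂ (lift π∈S')) = h u v π (inj₂ (v∈S' π π∈S'))

  -- At P, t realizes ∀X∀Y (X → Y → X ∪ Y) iff MustAt t; forward take
  -- X := Y := {π}.
  mustAtPole : (t : Λ) → (∣ MustType ∣⟨ P ⟩ empty) t ⇔ MustAt t
  mustAtPole t = mk⇔ useRealizer buildRealizer ⇔-∘ binaryRealizer (X ∪ Y) t
    where
    useRealizer : BinaryAt (X ∪ Y) t → MustAt t
    useRealizer r u v π u⋆π∈⊥⊥ v⋆π∈⊥⊥ =
      r ｛ π ｝ₛ ｛ π ｝ₛ u v π (singletonTruth u⋆π∈⊥⊥) (singletonTruth v⋆π∈⊥⊥) (lift refl , lift refl)
    buildRealizer : MustAt t → BinaryAt (X ∪ Y) t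
    buildRealizer h S S' u v π u∈S v∈S' (lift π∈S , lift π∈S') = h u v π (u∈S π π∈S) (v∈S' π π∈S')

module _ (𝒮 : RealizabilityStructure) where

  forAllPoles : ∀ {a b} {A : Pole → Set a} {B : Pole → Set b} → (∀ P → A P ⇔ B P) →
    (∀ P → 𝒮 P → A P) ⇔ (∀ P → 𝒮 P → B P)
  forAllPoles A⇔B = mk⇔ (λ a P P∈𝒮 → to (A⇔B P) (a P P∈𝒮))
                        (λ b P P∈𝒮 → from (A⇔B P) (b P P∈𝒮))

  singletonReduces : ∀ {p Q} →
    ｛ p ｝ ≻[ 𝒮 ] Q ⇔ (∀ P → 𝒮 P → Q ⊆ ⊥⊥ P → ⊥⊥ P p)
  singletonReduces {p} {Q} = mk⇔ witnessIsP (λ h P P∈𝒮 Q⊆⊥⊥ → p , refl , h P P∈𝒮 Q⊆⊥⊥)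
    where
    witnessIsP : ｛ p ｝ ≻[ 𝒮 ] Q → ∀ P → 𝒮 P → Q ⊆ ⊥⊥ P → ⊥⊥ P p
    witnessIsP h P P∈𝒮 Q⊆⊥⊥ with h P P∈𝒮 Q⊆⊥⊥
    ... | _ , refl , p∈⊥⊥ = p∈⊥⊥

  mayChoiceCriterion : (t : Λ) → MayChoice 𝒮 t ⇔ (∀ P → 𝒮 P → MayAt P t)
  mayChoiceCriterion t = mk⇔ polewise choice
    where
    polewise : MayChoice 𝒮 t → ∀ P → 𝒮 P → MayAt P t
    polewise m P P∈𝒮 u v π (inj₁ u⋆π∈⊥⊥) =
      to singletonReduces (proj₁ (m u v π)) P P∈𝒮 λ { refl → u⋆π∈⊥⊥ }
    polewise m P P∈𝒮 u v π (inj₂ v⋆π∈⊥⊥) =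
      to singletonReduces (proj₂ (m u v π)) P P∈𝒮 λ { refl → v⋆π∈⊥⊥ }
    choice : (∀ P → 𝒮 P → MayAt P t) → MayChoice 𝒮 t
    choice h u v π =
      from singletonReduces (λ P P∈𝒮 ⊆⊥⊥ → h P P∈𝒮 u v π (inj₁ (⊆⊥⊥ refl))) ,
      from singletonReduces (λ P P∈𝒮 ⊆⊥⊥ → h P P∈𝒮 u v π (inj₂ (⊆⊥⊥ refl)))

  mustChoiceCriterion : (t : Λ) → MustChoice 𝒮 t ⇔ (∀ P → 𝒮 P → MustAt P t)
  mustChoiceCriterion t = mk⇔ polewise choice
    where
    polewise : MustChoice 𝒮 t → ∀ P → 𝒮 P → MustAt P t
    polewise m P P∈𝒮 u v π u⋆π∈⊥⊥ v⋆π∈⊥⊥ =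
      to singletonReduces (m u v π) P P∈𝒮 λ { (inj₁ refl) → u⋆π∈⊥⊥ ; (inj₂ refl) → v⋆π∈⊥⊥ }
    choice : (∀ P → 𝒮 P → MustAt P t) → MustChoice 𝒮 t
    choice h u v π = from singletonReduces λ P P∈𝒮 ⊆⊥⊥ →
      h P P∈𝒮 u v π (⊆⊥⊥ (inj₁ refl)) (⊆⊥⊥ (inj₂ refl))

mainTheorem13 : (𝒮 : RealizabilityStructure) (t : Λ) →
    (MayChoice 𝒮 t ⇔ Realizes 𝒮 t MayType) × (MustChoice 𝒮 t ⇔ Realizes 𝒮 t MustType)
mainTheorem13 𝒮 t =
  ⇔-sym (forAllPoles 𝒮 (λ P → mayAtPole P t)) ⇔-∘ mayChoiceCriterion 𝒮 t ,
  ⇔-sym (forAllPoles 𝒮 (λ P → mustAtPole P t)) ⇔-∘ mustChoiceCriterion 𝒮 t
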